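{- Let $(B_+,\mathcal C_+,B_-,\mathcal C_-;\mathsf{con}_1,\mathsf{tot}_1)$ be a presentation of a pre-d-frame and $\mathcal G=(L_+,L_-;\mathsf{Con}_*,\mathsf{Tot}_*)$ the generated pre-d-frame. Then $\llbracket\cdot\rrbracket=(\llbracket\cdot\rrbracket_+,\llbracket\cdot\rrbracket_-)\colon(B_+,B_-)\to\mathcal G$ is presentation preserving. Moreover, if $\mathcal M$ is a pre-d-frame and $f=(f_+,f_-)\colon(B_+,B_-)\to\mathcal M$ is a presentation-preserving pair of maps, then there is a unique d-frame homomorphism $\overline f\colon\mathcal G\to\mathcal M$ with $f=\overline f\circ\llbracket\cdot\rrbracket$ (i.e. $f_\pm=\overline f_\pm\circ\llbracket\cdot\rrbracket_\pm$); its components $\overline f_\pm$ are the unique frame homomorphisms $L_\pm\to M_\pm$ with $f_\pm=\overline f_\pm\circ\llbracket\cdot\rrbracket_\pm$.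
   Context: A frame presentation $(B,\mathcal C)$: $B$ a meet-semilattice with top, $\mathcal C$ a set of pairs $U\dashv a$ ($a\in B$, $U\subseteq\downarrow a$) with $U\dashv a\in\mathcal C$, $b\le a\Rightarrow\{u\wedge b:u\in U\}\dashv b\in\mathcal C$. A $\mathcal C$-ideal is a downset $I\subseteq B$ with $U\dashv a\in\mathcal C,U\subseteq I\Rightarrow a\in I$; these form a frame under inclusion. A presentation of a pre-d-frame is $(B_+,\mathcal C_+,B_-,\mathcal C_-;\mathsf{con}_1,\mathsf{tot}_1)$ with $(B_\pm,\mathcal C_\pm)$ frame presentations and $\mathsf{con}_1,\mathsf{tot}_1\subseteq B_+\times B_-$. $L_\pm$ is the frame of $\mathcal C_\pm$-ideals and $\llbracket b\rrbracket_\pm$ is the smallest $\mathcal C_\pm$-ideal containing $b$. For frames $M_+,M_-$, on $M_+\times M_-$: $\alpha\sqsubseteq\beta$ iff $\alpha_+\le\beta_+,\alpha_-\le\beta_-$; logical join $(\alpha_+\vee\beta_+,\alpha_-\wedge\beta_-)$, logical meet $(\alpha_+\wedge\beta_+,\alpha_-\vee\beta_-)$; $tt=(1,0)$, $ff=(0,1)$. A pre-d-frame is $(M_+,M_-;\mathsf{con},\mathsf{tot})$ with $M_\pm$ frames, $\mathsf{con},\mathsf{tot}\subseteq M_+\times M_-$, $\mathsf{con}$ $\sqsubseteq$-downward closed, $\mathsf{tot}$ $\sqsubseteq$-upward closed, $tt,ff\in\mathsf{con}\cap\mathsf{tot}$, both closed under logical $\wedge,\vee$, and $\mathsf{con}$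 closed under coordinatewise joins of $\sqsubseteq$-directed sets. $\mathsf{Con}_*$ is the smallest such consistency relation on $L_+\times L_-$ containing $\{(\llbracket a\rrbracket_+,\llbracket b\rrbracket_-):(a,b)\in\mathsf{con}_1\}$, and $\mathsf{Tot}_*$ the smallest such totality relation containing $\{(\llbracket a\rrbracket_+,\llbracket b\rrbracket_-):(a,b)\in\mathsf{tot}_1\}$. A pair $f=(f_+,f_-)$ with $f_\pm\colon B_\pm\to M_\pm$ is presentation preserving if each $f_\pm$ is a meet-semilattice homomorphism with $\bigvee\{f_\pm(u):u\in U\}=f_\pm(a)$ for every $U\dashv a\in\mathcal C_\pm$, and $(f_+(a),f_-(b))\in\mathsf{con}$ for $(a,b)\in\mathsf{con}_1$, $(f_+(a),f_-(b))\in\mathsf{tot}$ for $(a,b)\in\mathsf{tot}_1$. A d-frame homomorphism is a pair of frame homomorphisms mapping $\mathsf{con}$ into $\mathsf{con}$ and $\mathsf{tot}$ into $\mathsf{tot}$ (coordinatewise). -}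

module Defs where

open import Level using (Level; _⊔_; 0ℓ) renaming (suc to lsuc)
open import Data.Bool using (Bool; true; false; if_then_else_)
open import Data.Empty using (⊥)
open import Data.Unit using (⊤; tt)
open import Data.Product using (Σ; ∃; _×_; _,_; proj₁; proj₂; uncurry′)
open import Relation.Binary.Core using (Rel)
open import Relation.Binary.Structures using (IsPartialOrder)
open import Relation.Binary.PropositionalEquality using (_≡_)
open import Algebra.Structures using (IsIdempotentCommutativeMonoid)

record MeetSL : Set₁ where
  infixr 7 _∧_
  infix 4 _≤_
  field
    Carrier : Set
    _∧_     : Carrier → Carrier → Carrier
    top     : Carrier
    isMeetSL : IsIdempotentCommutativeMonoid _≡_ _∧_ top

  _≤_ : Carrier → Carrier → Set
  a ≤ b = a ∧ b ≡ a

-- A set 𝒞 of covering pairs  U ⊣ a  on a meet-semilattice B,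
-- given as a family indexed by a (small) type Cov; each pair j has
-- target  tgt j = a  and covering subset  sub j = U ⊆ B.

record Coverage (B : MeetSL) : Set₁ where
  open MeetSL B
  field
    Cov : Set
    tgt : Cov → Carrier
    sub : Cov → Carrier → Set
    sub-below : ∀ j x → sub j x → x ≤ tgt j
    stable : ∀ j b → b ≤ tgt j →
      Σ Cov λ k → (tgt k ≡ b)
        × (∀ x → sub k x → ∃ λ u → sub j u × (x ≡ u ∧ b))
        × (∀ u → sub j u → sub k (u ∧ b))

record FrameOps (c ℓ : Level) : Set (lsuc (c ⊔ ℓ)) where
  infixr 7 _∧_
  infixr 6 _∨_
  infix 4 _≈_ _≤_
  field
    Carrier : Set c
    _≈_     : Rel Carrier ℓ
    _≤_     : Rel Carrier ℓ
    ⋁       : {I : Set} → (I → Carrier) → Carrier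
    _∧_     : Carrier → Carrier → Carrier
    ⊤F      : Carrier

  _∨_ : Carrier → Carrier → Carrier
  a ∨ b = ⋁ {Bool} (λ x → if x then a else b)

  ⊥F : Carrier
  ⊥F = ⋁ {⊥} (λ ())

record IsFrame {c ℓ : Level} (F : FrameOps c ℓ) : Set (lsuc (c ⊔ ℓ)) where
  open FrameOps F
  field
    isPartialOrder : IsPartialOrder _≈_ _≤_
    ⋁-upper : ∀ {I : Set} (G : I → Carrier) (i : I) → G i ≤ ⋁ G
    ⋁-least : ∀ {I : Set} (G : I → Carrier) (x : Carrier) → (∀ i → G i ≤ x) → ⋁ G ≤ x
    ∧-lowerˡ : ∀ a b → a ∧ b ≤ a
    ∧-lowerʳ : ∀ a b → a ∧ b ≤ b
    ∧-greatest : ∀ a b x → x ≤ a → x ≤ b → x ≤ a ∧ b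
    ⊤-maximum : ∀ a → a ≤ ⊤F
    distrib : ∀ (a : Carrier) {I : Set} (G : I → Carrier) → a ∧ ⋁ G ≤ ⋁ (λ i → a ∧ G i)

record Frame (c ℓ : Level) : Set (lsuc (c ⊔ ℓ)) where
  field
    ops     : FrameOps c ℓ
    isFrame : IsFrame ops
  open FrameOps ops public
  open IsFrame isFrame public

record IsFrameHom {c ℓ c' ℓ' : Level} (A : FrameOps c ℓ) (B : FrameOps c' ℓ')
                  (h : FrameOps.Carrier A → FrameOps.Carrier B) : Set (lsuc (c ⊔ ℓ ⊔ c' ⊔ ℓ')) where
  private
    module A = FrameOps A
    module B = FrameOps B
  field
    cong  : ∀ {x y} → x A.≈ y → h x B.≈ h y
    pres-⋁ : ∀ {I : Set} (G : I → A.Carrier) → h (A.⋁ G) B.≈ B.⋁ (λ i → h (G i))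
    pres-∧ : ∀ x y → h (x A.∧ y) B.≈ (h x B.∧ h y)
    pres-⊤ : h A.⊤F B.≈ B.⊤F

record PreDFrameOps (c ℓ r : Level) : Set (lsuc (c ⊔ ℓ ⊔ r)) where
  field
    M₊ M₋ : FrameOps c ℓ
    con tot : FrameOps.Carrier M₊ → FrameOps.Carrier M₋ → Set r

module _ {c ℓ : Level} (M₊ M₋ : FrameOps c ℓ) where
  private
    module P = FrameOps M₊
    module N = FrameOps M₋

  _⊑_ : (P.Carrier × N.Carrier) → (P.Carrier × N.Carrier) → Set ℓ
  (a₊ , a₋) ⊑ (b₊ , b₋) = (a₊ P.≤ b₊) × (a₋ N.≤ b₋)

  _∧ₗ_ : (P.Carrier × N.Carrier) → (P.Carrier × N.Carrier) → (P.Carrier × N.Carrier)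
  (a₊ , a₋) ∧ₗ (b₊ , b₋) = (a₊ P.∧ b₊ , a₋ N.∨ b₋)

  _∨ₗ_ : (P.Carrier × N.Carrier) → (P.Carrier × N.Carrier) → (P.Carrier × N.Carrier)
  (a₊ , a₋) ∨ₗ (b₊ , b₋) = (a₊ P.∨ b₊ , a₋ N.∧ b₋)

  ttₗ ffₗ : P.Carrier × N.Carrier
  ttₗ = (P.⊤F , N.⊥F)
  ffₗ = (P.⊥F , N.⊤F)

  Directed : {I : Set} → (I → P.Carrier × N.Carrier) → Set ℓ
  Directed {I} G = I × (∀ i j → Σ I λ k → (G i ⊑ G k) × (G j ⊑ G k))

  ⋁ₗ : {I : Set} → (I → P.Carrier × N.Carrier) → P.Carrier × N.Carrier
  ⋁ₗ G = (P.⋁ (λ i → proj₁ (G i)) , N.⋁ (λ i → proj₂ (G i)))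

record IsPreDFrame {c ℓ r : Level} (D : PreDFrameOps c ℓ r) : Set (lsuc (c ⊔ ℓ ⊔ r)) where
  open PreDFrameOps D
  private
    CON = uncurry′ con
    TOT = uncurry′ tot
  field
    frame₊ : IsFrame M₊
    frame₋ : IsFrame M₋
    con-down : ∀ α β → _⊑_ M₊ M₋ α β → CON β → CON α
    tot-up   : ∀ α β → _⊑_ M₊ M₋ α β → TOT α → TOT β
    con-tt : CON (ttₗ M₊ M₋)
    con-ff : CON (ffₗ M₊ M₋)
    tot-tt : TOT (ttₗ M₊ M₋)
    tot-ff : TOT (ffₗ M₊ M₋)
    con-∧ : ∀ α β → CON α → CON β → CON (_∧ₗ_ M₊ M₋ α β)
    con-∨ : ∀ α β → CON α → CON β → CON (_∨ₗ_ M₊ M₋ α β)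
    tot-∧ : ∀ α β → TOT α → TOT β → TOT (_∧ₗ_ M₊ M₋ α β)
    tot-∨ : ∀ α β → TOT α → TOT β → TOT (_∨ₗ_ M₊ M₋ α β)
    con-directed : ∀ {I : Set} (G : I → FrameOps.Carrier M₊ × FrameOps.Carrier M₋) →
      Directed M₊ M₋ G → (∀ i → CON (G i)) → CON (⋁ₗ M₊ M₋ G)

record PreDFrame (c ℓ r : Level) : Set (lsuc (c ⊔ ℓ ⊔ r)) where
  field
    ops : PreDFrameOps c ℓ r
    isPreDFrame : IsPreDFrame ops
  open PreDFrameOps ops public

record IsDFrameHom {c ℓ r c' ℓ' r' : Level} (G : PreDFrameOps c ℓ r) (M : PreDFrameOps c' ℓ' r')
    (h₊ : FrameOps.Carrier (PreDFrameOps.M₊ G) → FrameOps.Carrier (PreDFrameOps.M₊ M))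
    (h₋ : FrameOps.Carrier (PreDFrameOps.M₋ G) → FrameOps.Carrier (PreDFrameOps.M₋ M))
    : Set (lsuc (c ⊔ ℓ ⊔ r ⊔ c' ⊔ ℓ' ⊔ r')) where
  private
    module G = PreDFrameOps G
    module M = PreDFrameOps M
  field
    hom₊ : IsFrameHom G.M₊ M.M₊ h₊
    hom₋ : IsFrameHom G.M₋ M.M₋ h₋
    pres-con : ∀ a b → G.con a b → M.con (h₊ a) (h₋ b)
    pres-tot : ∀ a b → G.tot a b → M.tot (h₊ a) (h₋ b)

module Ideals (B : MeetSL) (C : Coverage B) where
  open MeetSL B
  open Coverage C

  record Ideal : Set₁ where
    field
      pred   : Carrier → Set
      down   : ∀ {x y} → x ≤ y → pred y → pred x
      closed : ∀ j → (∀ x → sub j x → pred x) → pred (tgt j)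
  open Ideal public

  data Gen (S : Carrier → Set) : Carrier → Set where
    base  : ∀ {x} → S x → Gen S x
    gdown  : ∀ {x y} → x ≤ y → Gen S y → Gen S x
    gcover : ∀ j → (∀ x → sub j x → Gen S x) → Gen S (tgt j)

  genIdeal : (Carrier → Set) → Ideal
  genIdeal S = record { pred = Gen S ; down = gdown ; closed = gcover }

  ⟦_⟧ : Carrier → Ideal
  ⟦ b ⟧ = genIdeal (λ x → x ≡ b)

  IdealFrame : FrameOps (lsuc 0ℓ) 0ℓ
  IdealFrame = record
    { Carrier = Ideal
    ; _≈_ = λ I J → (∀ x → pred I x → pred J x) × (∀ x → pred J x → pred I x)
    ; _≤_ = λ I J → ∀ x → pred I x → pred J x
    ; ⋁ = λ {I} G → genIdeal (λ x → Σ I λ i → pred (G i) x)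
    ; _∧_ = λ I J → record
        { pred = λ x → pred I x × pred J x
        ; down = λ x≤y p → Ideal.down I x≤y (proj₁ p) , Ideal.down J x≤y (proj₂ p)
        ; closed = λ j h → Ideal.closed I j (λ x s → proj₁ (h x s))
                         , Ideal.closed J j (λ x s → proj₂ (h x s)) }
    ; ⊤F = record { pred = λ _ → ⊤ ; down = λ _ _ → tt ; closed = λ _ _ → tt }
    }

record Presentation : Set₁ where
  field
    B₊ B₋ : MeetSL
    𝒞₊ : Coverage B₊
    𝒞₋ : Coverage B₋
    con₁ tot₁ : MeetSL.Carrier B₊ → MeetSL.Carrier B₋ → Set

module Generated (P : Presentation) where
  open Presentation P
  module I₊ = Ideals B₊ 𝒞₊
  module I₋ = Ideals B₋ 𝒞₋

  L₊ L₋ : FrameOps (lsuc 0ℓ) 0ℓ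
  L₊ = I₊.IdealFrame
  L₋ = I₋.IdealFrame

  ⟦_⟧₊ = I₊.⟦_⟧
  ⟦_⟧₋ = I₋.⟦_⟧

  private
    LP = FrameOps.Carrier L₊ × FrameOps.Carrier L₋

  data Con* : FrameOps.Carrier L₊ → FrameOps.Carrier L₋ → Set₁ where
    gen  : ∀ a b → con₁ a b → Con* ⟦ a ⟧₊ ⟦ b ⟧₋
    down : ∀ (α β : LP) → _⊑_ L₊ L₋ α β → Con* (proj₁ β) (proj₂ β) → Con* (proj₁ α) (proj₂ α)
    tt*  : Con* (proj₁ (ttₗ L₊ L₋)) (proj₂ (ttₗ L₊ L₋))
    ff*  : Con* (proj₁ (ffₗ L₊ L₋)) (proj₂ (ffₗ L₊ L₋))
    ∧*   : ∀ (α β : LP) → Con* (proj₁ α) (proj₂ α) → Con* (proj₁ β) (proj₂ β) →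
           Con* (proj₁ (_∧ₗ_ L₊ L₋ α β)) (proj₂ (_∧ₗ_ L₊ L₋ α β))
    ∨*   : ∀ (α β : LP) → Con* (proj₁ α) (proj₂ α) → Con* (proj₁ β) (proj₂ β) →
           Con* (proj₁ (_∨ₗ_ L₊ L₋ α β)) (proj₂ (_∨ₗ_ L₊ L₋ α β))
    dir* : ∀ {I : Set} (G : I → LP) → Directed L₊ L₋ G →
           (∀ i → Con* (proj₁ (G i)) (proj₂ (G i))) →
           Con* (proj₁ (⋁ₗ L₊ L₋ G)) (proj₂ (⋁ₗ L₊ L₋ G))

  data Tot* : FrameOps.Carrier L₊ → FrameOps.Carrier L₋ → Set₁ where
    gen  : ∀ a b → tot₁ a b → Tot* ⟦ a ⟧₊ ⟦ b ⟧₋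
    up   : ∀ (α β : LP) → _⊑_ L₊ L₋ α β → Tot* (proj₁ α) (proj₂ α) → Tot* (proj₁ β) (proj₂ β)
    tt*  : Tot* (proj₁ (ttₗ L₊ L₋)) (proj₂ (ttₗ L₊ L₋))
    ff*  : Tot* (proj₁ (ffₗ L₊ L₋)) (proj₂ (ffₗ L₊ L₋))
    ∧*   : ∀ (α β : LP) → Tot* (proj₁ α) (proj₂ α) → Tot* (proj₁ β) (proj₂ β) →
           Tot* (proj₁ (_∧ₗ_ L₊ L₋ α β)) (proj₂ (_∧ₗ_ L₊ L₋ α β))
    ∨*   : ∀ (α β : LP) → Tot* (proj₁ α) (proj₂ α) → Tot* (proj₁ β) (proj₂ β) →
           Tot* (proj₁ (_∨ₗ_ L₊ L₋ α β)) (proj₂ (_∨ₗ_ L₊ L₋ α β))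

  𝒢 : PreDFrameOps (lsuc 0ℓ) 0ℓ (lsuc 0ℓ)
  𝒢 = record { M₊ = L₊ ; M₋ = L₋ ; con = Con* ; tot = Tot* }

record IsCoverPreserving {c ℓ : Level} (B : MeetSL) (C : Coverage B) (M : FrameOps c ℓ)
                         (f : MeetSL.Carrier B → FrameOps.Carrier M) : Set (lsuc (c ⊔ ℓ)) where
  private
    module B = MeetSL B
    module C = Coverage C
    module M = FrameOps M
  field
    pres-∧ : ∀ a b → f (a B.∧ b) M.≈ (f a M.∧ f b)
    pres-top : f B.top M.≈ M.⊤F
    pres-cover : ∀ j → M.⋁ {Σ B.Carrier (C.sub j)} (λ u → f (proj₁ u)) M.≈ f (C.tgt j)

record IsPresentationPreserving {c ℓ r : Level} (P : Presentation) (M : PreDFrameOps c ℓ r)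
    (f₊ : MeetSL.Carrier (Presentation.B₊ P) → FrameOps.Carrier (PreDFrameOps.M₊ M))
    (f₋ : MeetSL.Carrier (Presentation.B₋ P) → FrameOps.Carrier (PreDFrameOps.M₋ M))
    : Set (lsuc (c ⊔ ℓ ⊔ r)) where
  private
    module P = Presentation P
    module M = PreDFrameOps M
  field
    cov₊ : IsCoverPreserving P.B₊ P.𝒞₊ M.M₊ f₊
    cov₋ : IsCoverPreserving P.B₋ P.𝒞₋ M.M₋ f₋
    pres-con : ∀ a b → P.con₁ a b → M.con (f₊ a) (f₋ b)
    pres-tot : ∀ a b → P.tot₁ a b → M.tot (f₊ a) (f₋ b)

-- ⟦·⟧ preserves meets because, by meet stability of 𝒞, x ↦ x ∧ c pulls 𝒞-ideals back
-- to 𝒞-ideals; it preserves covers by construction. Every 𝒞-ideal is the join of the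
-- principal ideals ⟦x⟧ it contains, so a frame homomorphism out of L is determined by
-- its values on ⟦·⟧: this gives uniqueness. For existence, send an ideal I to
-- ⋁{f x : x ∈ I}. Since f preserves covers, {x : f x ≤ m} is closed under the rules
-- generating 𝒞-ideals, which is what makes this map agree with f on ⟦·⟧ and preserve
-- joins; meets are preserved by distributivity. Finally, frame homomorphisms commute
-- with the logical operations, so by minimality of Con* and Tot* the extension
-- preserves con and tot as soon as it does so on the generators.
module Submission where

open import Defs
open import Level using (Level)
open import Data.Bool using (true; false)
open import Data.Empty using (⊥)
open import Data.Unit using (tt)
open import Data.Product using (Σ; _×_; _,_; proj₁; proj₂)
open import Relation.Binary.Bundles using (Poset)
open import Relation.Binary.PropositionalEquality as ≡ using (_≡_; refl; subst)
open import Algebra.Structures using (IsIdempotentCommutativeMonoid)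
import Relation.Binary.Reasoning.PartialOrder as PosetReasoning
import Relation.Binary.Reasoning.Setoid as SetoidReasoning

module MeetSLOrder (B : MeetSL) where
  open MeetSL B
  open IsIdempotentCommutativeMonoid isMeetSL using (assoc; comm; idem; identityʳ)
  open ≡.≡-Reasoning

  ≤-trans : ∀ {a b c} → a ≤ b → b ≤ c → a ≤ c
  ≤-trans {a} {b} {c} a≤b b≤c = begin
    a ∧ c        ≡⟨ ≡.cong (_∧ c) a≤b ⟨
    (a ∧ b) ∧ c  ≡⟨ assoc a b c ⟩
    a ∧ (b ∧ c)  ≡⟨ ≡.cong (a ∧_) b≤c ⟩
    a ∧ b        ≡⟨ a≤b ⟩
    a            ∎

  ∧-greatest : ∀ {x a b} → x ≤ a → x ≤ b → x ≤ a ∧ b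
  ∧-greatest {x} {a} {b} x≤a x≤b = begin
    x ∧ (a ∧ b)  ≡⟨ assoc x a b ⟨
    (x ∧ a) ∧ b  ≡⟨ ≡.cong (_∧ b) x≤a ⟩
    x ∧ b        ≡⟨ x≤b ⟩
    x            ∎

  x∧y≤x : ∀ x y → x ∧ y ≤ x
  x∧y≤x x y = begin
    (x ∧ y) ∧ x  ≡⟨ comm (x ∧ y) x ⟩
    x ∧ (x ∧ y)  ≡⟨ assoc x x y ⟨
    (x ∧ x) ∧ y  ≡⟨ ≡.cong (_∧ y) (idem x) ⟩
    x ∧ y        ∎

  x∧y≤y : ∀ x y → x ∧ y ≤ y
  x∧y≤y x y = begin
    (x ∧ y) ∧ y  ≡⟨ assoc x y y ⟩
    x ∧ (y ∧ y)  ≡⟨ ≡.cong (x ∧_) (idem y) ⟩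
    x ∧ y        ∎

  ≤-top : ∀ x → x ≤ top
  ≤-top = identityʳ

  ∧-monoˡ-≤ : ∀ {x y} c → x ≤ y → x ∧ c ≤ y ∧ c
  ∧-monoˡ-≤ {x} c x≤y = ∧-greatest (≤-trans (x∧y≤x x c) x≤y) (x∧y≤y x c)

module FrameProperties {c ℓ : Level} {F : FrameOps c ℓ} (isF : IsFrame F) where
  open FrameOps F
  open IsFrame isF public

  poset : Poset c ℓ ℓ
  poset = record { isPartialOrder = isPartialOrder }

  open Poset poset public using (reflexive; antisym) renaming (refl to ≤-refl; trans to ≤-trans)
  module ≈ = Poset.Eq poset
  module ≤-Reasoning = PosetReasoning poset
  module ≈-Reasoning = SetoidReasoning ≈.setoid

  ⋁-dominated : ∀ {I J : Set} (G : I → Carrier) (H : J → Carrier) →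
                (∀ i → Σ J λ j → G i ≤ H j) → ⋁ G ≤ ⋁ H
  ⋁-dominated G H dom = ⋁-least G (⋁ H) λ i → ≤-trans (proj₂ (dom i)) (⋁-upper H (proj₁ (dom i)))

  ⋁-cong : ∀ {I : Set} {G H : I → Carrier} → (∀ i → G i ≈ H i) → ⋁ G ≈ ⋁ H
  ⋁-cong {G = G} {H} G≈H =
    antisym (⋁-dominated G H λ i → i , reflexive (G≈H i))
            (⋁-dominated H G λ i → i , reflexive (≈.sym (G≈H i)))

  ⋁-empty : (G : ⊥ → Carrier) → ⋁ G ≈ ⊥F
  ⋁-empty G = antisym (⋁-least G ⊥F λ ()) (⋁-least _ (⋁ G) λ ())

  ∧-comm-≤ : ∀ a b → a ∧ b ≤ b ∧ a
  ∧-comm-≤ a b = ∧-greatest b a (a ∧ b) (∧-lowerʳ a b) (∧-lowerˡ a b)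

  ⋁-∧-⋁ : ∀ {I J : Set} (G : I → Carrier) (H : J → Carrier) →
          ⋁ G ∧ ⋁ H ≤ ⋁ {I × J} (λ (i , j) → G i ∧ H j)
  ⋁-∧-⋁ G H = ≤-trans (distrib (⋁ G) H) (⋁-least _ _ λ j → begin
    ⋁ G ∧ H j              ≤⟨ ∧-comm-≤ (⋁ G) (H j) ⟩
    H j ∧ ⋁ G              ≤⟨ distrib (H j) G ⟩
    ⋁ (λ i → H j ∧ G i)    ≤⟨ ⋁-dominated _ _ (λ i → (i , j) , ∧-comm-≤ (H j) (G i)) ⟩
    ⋁ (λ (i , j) → G i ∧ H j) ∎)
    where open ≤-Reasoning

module FrameHomProperties {c ℓ c′ ℓ′ : Level} {A : FrameOps c ℓ} {F : FrameOps c′ ℓ′}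
                          (isF : IsFrame F) {h : FrameOps.Carrier A → FrameOps.Carrier F}
                          (hom : IsFrameHom A F h) where
  private
    module A = FrameOps A
  open FrameOps F
  open FrameProperties isF
  open IsFrameHom hom

  pres-⊥ : h A.⊥F ≈ ⊥F
  pres-⊥ = ≈.trans (pres-⋁ _) (⋁-empty _)

  pres-∨ : ∀ x y → h (x A.∨ y) ≈ h x ∨ h y
  pres-∨ x y = ≈.trans (pres-⋁ _) (⋁-cong λ { true → ≈.refl ; false → ≈.refl })

module CoverIdeals (B : MeetSL) (C : Coverage B) where
  open MeetSL B
  open IsIdempotentCommutativeMonoid isMeetSL using (comm; idem)
  open Coverage C
  open Ideals B C
  open MeetSLOrder B
  private
    module L = FrameOps IdealFrame

  Gen-minimal : ∀ {S : Carrier → Set} (I : Ideal) → (∀ x → S x → pred I x) → ∀ x → Gen S x → pred I x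
  Gen-minimal I S⊆I x (base s) = S⊆I x s
  Gen-minimal I S⊆I x (gdown x≤y g) = down I x≤y (Gen-minimal I S⊆I _ g)
  Gen-minimal I S⊆I _ (gcover j g) = closed I j λ u s → Gen-minimal I S⊆I u (g u s)

  ⟦⟧-least : ∀ {a} (I : Ideal) → pred I a → ⟦ a ⟧ L.≤ I
  ⟦⟧-least I a∈I = Gen-minimal I λ { _ refl → a∈I }

  ≤⇒∈⟦⟧ : ∀ {x a} → x ≤ a → pred ⟦ a ⟧ x
  ≤⇒∈⟦⟧ x≤a = gdown x≤a (base refl)

  ⟦⟧-mono : ∀ {a b} → a ≤ b → ⟦ a ⟧ L.≤ ⟦ b ⟧
  ⟦⟧-mono {b = b} a≤b = ⟦⟧-least ⟦ b ⟧ (≤⇒∈⟦⟧ a≤b)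

  ∧-preimage : Ideal → Carrier → Ideal
  ∧-preimage I c = record
    { pred   = λ x → pred I (x ∧ c)
    ; down   = λ x≤y → down I (∧-monoˡ-≤ c x≤y)
    ; closed = cover-closed
    }
    where
    cover-closed : ∀ j → (∀ u → sub j u → pred I (u ∧ c)) → pred I (tgt j ∧ c)
    cover-closed j U∧c⊆I with stable j (tgt j ∧ c) (x∧y≤x (tgt j) c)
    ... | k , tgt-k≡ , k-from-j , _ = subst (pred I) tgt-k≡ (closed I k λ z z∈k → z∈I (k-from-j z z∈k))
      where
      z∈I : ∀ {z} → Σ Carrier (λ u → sub j u × (z ≡ u ∧ (tgt j ∧ c))) → pred I z
      z∈I {z} (u , u∈j , z≡) = down I z≤u∧c (U∧c⊆I u u∈j)
        where
        z≤u∧c : z ≤ u ∧ c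
        z≤u∧c = subst (_≤ u ∧ c) (≡.sym z≡)
                  (∧-greatest (x∧y≤x u _) (≤-trans (x∧y≤y u _) (x∧y≤y (tgt j) c)))

  ⟦⟧-∧ : ∀ {a b x y} → pred ⟦ a ⟧ x → pred ⟦ b ⟧ y → pred ⟦ a ∧ b ⟧ (x ∧ y)
  ⟦⟧-∧ {a} {b} {x} {y} x∈a y∈b = ⟦⟧-least (∧-preimage ⟦ a ∧ b ⟧ y) a∧y∈a∧b x x∈a
    where
    a∧y∈a∧b : pred ⟦ a ∧ b ⟧ (a ∧ y)
    a∧y∈a∧b = subst (pred ⟦ a ∧ b ⟧) (comm y a)
                (⟦⟧-least (∧-preimage ⟦ a ∧ b ⟧ a) (base (comm b a)) y y∈b)

  ⟦⟧-isCoverPreserving : IsCoverPreserving B C IdealFrame ⟦_⟧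
  ⟦⟧-isCoverPreserving = record
    { pres-∧ = λ a b →
        (λ x x∈a∧b → ⟦⟧-mono (x∧y≤x a b) x x∈a∧b , ⟦⟧-mono (x∧y≤y a b) x x∈a∧b)
      , (λ x (x∈a , x∈b) → subst (pred ⟦ a ∧ b ⟧) (idem x) (⟦⟧-∧ x∈a x∈b))
    ; pres-top = (λ _ _ → tt) , (λ x _ → ≤⇒∈⟦⟧ (≤-top x))
    ; pres-cover = λ j →
        Gen-minimal ⟦ tgt j ⟧ (λ x ((u , u∈j) , x∈u) → ⟦⟧-mono (sub-below j u u∈j) x x∈u)
      , ⟦⟧-least (L.⋁ λ (u : Σ Carrier (sub j)) → ⟦ proj₁ u ⟧)
                 (gcover j λ u u∈j → base ((u , u∈j) , base refl))
    }

  ⋁-principal : ∀ (I : Ideal) → I L.≈ L.⋁ {Σ Carrier (pred I)} (λ (x , _) → ⟦ x ⟧)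
  ⋁-principal I = (λ x x∈I → base ((x , x∈I) , base refl))
                , Gen-minimal I λ x ((y , y∈I) , x∈y) → ⟦⟧-least I y∈I x x∈y

  hom-mono : ∀ {c ℓ} {F : FrameOps c ℓ} → IsFrame F → ∀ {g} → IsFrameHom IdealFrame F g →
             ∀ {I J} → I L.≤ J → FrameOps._≤_ F (g I) (g J)
  hom-mono isF {g} hom {I} {J} I⊆J =
    F.≤-trans (F.reflexive (F.≈.trans (cong I≈I∩J) (pres-∧ I J))) (F.∧-lowerʳ (g I) (g J))
    where
    module F = FrameProperties isF
    open IsFrameHom hom
    I≈I∩J : I L.≈ I L.∧ J
    I≈I∩J = (λ x x∈I → x∈I , I⊆J x x∈I) , (λ x → proj₁)

module Extension {c ℓ : Level} (B : MeetSL) (C : Coverage B) {F : FrameOps c ℓ} (isF : IsFrame F)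
                 {f : MeetSL.Carrier B → FrameOps.Carrier F} (cp : IsCoverPreserving B C F f) where
  open Coverage C
  open Ideals B C
  private
    module B = MeetSL B
    module L = FrameOps IdealFrame
  open CoverIdeals B C
  open MeetSLOrder B using (x∧y≤x; x∧y≤y)
  open FrameOps F
  open FrameProperties isF
  open IsCoverPreserving cp

  f-mono : ∀ {x y} → x B.≤ y → f x ≤ f y
  f-mono {x} {y} x∧y≡x = ≤-trans (reflexive fx≈fx∧fy) (∧-lowerʳ (f x) (f y))
    where
    fx≈fx∧fy : f x ≈ f x ∧ f y
    fx≈fx∧fy = subst (λ z → f z ≈ f x ∧ f y) x∧y≡x (pres-∧ x y)

  Gen-below : ∀ {S : B.Carrier → Set} {m} → (∀ x → S x → f x ≤ m) → ∀ x → Gen S x → f x ≤ m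
  Gen-below fS≤m x (base s) = fS≤m x s
  Gen-below fS≤m x (gdown x≤y g) = ≤-trans (f-mono x≤y) (Gen-below fS≤m _ g)
  Gen-below fS≤m _ (gcover j g) = ≤-trans (reflexive (≈.sym (pres-cover j)))
                                          (⋁-least _ _ λ (u , u∈j) → Gen-below fS≤m u (g u u∈j))

  extend : Ideal → Carrier
  extend I = ⋁ {Σ B.Carrier (pred I)} λ (x , _) → f x

  extend-mono : ∀ {I J} → I L.≤ J → extend I ≤ extend J
  extend-mono I⊆J = ⋁-dominated _ _ λ (x , x∈I) → (x , I⊆J x x∈I) , ≤-refl

  extend-⟦⟧ : ∀ a → extend ⟦ a ⟧ ≈ f a
  extend-⟦⟧ a = antisym (⋁-least _ _ λ (x , x∈a) → Gen-below (λ { _ refl → ≤-refl }) x x∈a)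
                        (⋁-upper _ (a , base refl))

  extend-⋁ : ∀ {I : Set} (G : I → Ideal) → extend (L.⋁ G) ≈ ⋁ (λ i → extend (G i))
  extend-⋁ G = antisym
    (⋁-least _ _ λ (x , x∈⋁G) →
       Gen-below (λ y (i , y∈Gi) → ≤-trans (⋁-upper _ (y , y∈Gi)) (⋁-upper _ i)) x x∈⋁G)
    (⋁-least _ _ λ i → extend-mono {G i} {L.⋁ G} λ x x∈Gi → base (i , x∈Gi))

  extend-∧ : ∀ I J → extend (I L.∧ J) ≈ extend I ∧ extend J
  extend-∧ I J = antisym
    (∧-greatest _ _ _ (extend-mono {I L.∧ J} {I} λ _ → proj₁) (extend-mono {I L.∧ J} {J} λ _ → proj₂))
    (≤-trans (⋁-∧-⋁ _ _) (⋁-dominated _ _ λ ((x , x∈I) , (y , y∈J)) →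
       (x B.∧ y , down I (x∧y≤x x y) x∈I , down J (x∧y≤y x y) y∈J) , reflexive (≈.sym (pres-∧ x y))))

  extend-⊤ : extend L.⊤F ≈ ⊤F
  extend-⊤ = antisym (⊤-maximum _) (≤-trans (reflexive (≈.sym pres-top)) (⋁-upper _ (B.top , tt)))

  extend-isFrameHom : IsFrameHom IdealFrame F extend
  extend-isFrameHom = record
    { cong   = λ {I} {J} (I⊆J , J⊆I) → antisym (extend-mono {I} {J} I⊆J) (extend-mono {J} {I} J⊆I)
    ; pres-⋁ = extend-⋁
    ; pres-∧ = extend-∧
    ; pres-⊤ = extend-⊤
    }

  extend-unique : ∀ g → IsFrameHom IdealFrame F g → (∀ a → g ⟦ a ⟧ ≈ f a) → ∀ I → g I ≈ extend I
  extend-unique g hom g⟦⟧≈f I = begin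
    g I                                 ≈⟨ G.cong (⋁-principal I) ⟩
    g (L.⋁ λ (x , _) → ⟦ x ⟧)           ≈⟨ G.pres-⋁ _ ⟩
    ⋁ (λ (x , _) → g ⟦ x ⟧)             ≈⟨ ⋁-cong (λ (x , _) → g⟦⟧≈f x) ⟩
    extend I                            ∎
    where
    module G = IsFrameHom hom
    open ≈-Reasoning

module GeneratedPreDFrame (P : Presentation) where
  open Presentation P
  open Generated P

  module _ {c ℓ r : Level} (M : PreDFrame c ℓ r)
           {h₊ : FrameOps.Carrier L₊ → FrameOps.Carrier (PreDFrame.M₊ M)}
           {h₋ : FrameOps.Carrier L₋ → FrameOps.Carrier (PreDFrame.M₋ M)}
           (hom₊ : IsFrameHom L₊ (PreDFrame.M₊ M) h₊) (hom₋ : IsFrameHom L₋ (PreDFrame.M₋ M) h₋) where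
    open PreDFrame M
    open IsPreDFrame isPreDFrame
    private
      module M₊ = FrameOps M₊
      module M₋ = FrameOps M₋
      module F₊ = FrameProperties frame₊
      module F₋ = FrameProperties frame₋
      module H₊ = FrameHomProperties frame₊ hom₊
      module H₋ = FrameHomProperties frame₋ hom₋
      module h₊ = IsFrameHom hom₊
      module h₋ = IsFrameHom hom₋

      LP = FrameOps.Carrier L₊ × FrameOps.Carrier L₋
      MP = M₊.Carrier × M₋.Carrier

    _≈ₗ_ : MP → MP → Set ℓ
    (a₊ , a₋) ≈ₗ (b₊ , b₋) = (a₊ M₊.≈ b₊) × (a₋ M₋.≈ b₋)

    ≈ₗ⇒⊑ : ∀ {α β} → α ≈ₗ β → _⊑_ M₊ M₋ α β
    ≈ₗ⇒⊑ (p₊ , p₋) = F₊.reflexive p₊ , F₋.reflexive p₋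

    ≈ₗ⇒⊒ : ∀ {α β} → α ≈ₗ β → _⊑_ M₊ M₋ β α
    ≈ₗ⇒⊒ (p₊ , p₋) = F₊.reflexive (F₊.≈.sym p₊) , F₋.reflexive (F₋.≈.sym p₋)

    image : LP → MP
    image (x₊ , x₋) = h₊ x₊ , h₋ x₋

    image-⊑ : ∀ {α β} → _⊑_ L₊ L₋ α β → _⊑_ M₊ M₋ (image α) (image β)
    image-⊑ (p₊ , p₋) = CoverIdeals.hom-mono B₊ 𝒞₊ frame₊ hom₊ p₊
                      , CoverIdeals.hom-mono B₋ 𝒞₋ frame₋ hom₋ p₋

    image-tt : image (ttₗ L₊ L₋) ≈ₗ ttₗ M₊ M₋
    image-tt = h₊.pres-⊤ , H₋.pres-⊥

    image-ff : image (ffₗ L₊ L₋) ≈ₗ ffₗ M₊ M₋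
    image-ff = H₊.pres-⊥ , h₋.pres-⊤

    image-∧ₗ : ∀ α β → image (_∧ₗ_ L₊ L₋ α β) ≈ₗ _∧ₗ_ M₊ M₋ (image α) (image β)
    image-∧ₗ (a₊ , a₋) (b₊ , b₋) = h₊.pres-∧ a₊ b₊ , H₋.pres-∨ a₋ b₋

    image-∨ₗ : ∀ α β → image (_∨ₗ_ L₊ L₋ α β) ≈ₗ _∨ₗ_ M₊ M₋ (image α) (image β)
    image-∨ₗ (a₊ , a₋) (b₊ , b₋) = H₊.pres-∨ a₊ b₊ , h₋.pres-∧ a₋ b₋

    image-⋁ₗ : ∀ {I : Set} (G : I → LP) → image (⋁ₗ L₊ L₋ G) ≈ₗ ⋁ₗ M₊ M₋ (λ i → image (G i))
    image-⋁ₗ G = h₊.pres-⋁ _ , h₋.pres-⋁ _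

    image-directed : ∀ {I : Set} {G : I → LP} → Directed L₊ L₋ G → Directed M₊ M₋ (λ i → image (G i))
    image-directed (i₀ , upper) = i₀ , λ i j →
      let (k , Gi⊑Gk , Gj⊑Gk) = upper i j in k , image-⊑ Gi⊑Gk , image-⊑ Gj⊑Gk

    pres-Con* : (∀ a b → con₁ a b → con (h₊ ⟦ a ⟧₊) (h₋ ⟦ b ⟧₋)) → ∀ {x y} → Con* x y → con (h₊ x) (h₋ y)
    pres-Con* gens (gen a b ab) = gens a b ab
    pres-Con* gens (down α β α⊑β β∈) = con-down (image α) (image β) (image-⊑ α⊑β) (pres-Con* gens β∈)
    pres-Con* gens tt* = con-down _ _ (≈ₗ⇒⊑ image-tt) con-tt
    pres-Con* gens ff* = con-down _ _ (≈ₗ⇒⊑ image-ff) con-ff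
    pres-Con* gens (∧* α β α∈ β∈) =
      con-down _ _ (≈ₗ⇒⊑ (image-∧ₗ α β)) (con-∧ (image α) (image β) (pres-Con* gens α∈) (pres-Con* gens β∈))
    pres-Con* gens (∨* α β α∈ β∈) =
      con-down _ _ (≈ₗ⇒⊑ (image-∨ₗ α β)) (con-∨ (image α) (image β) (pres-Con* gens α∈) (pres-Con* gens β∈))
    pres-Con* gens (dir* G dir G∈) =
      con-down _ _ (≈ₗ⇒⊑ (image-⋁ₗ G)) (con-directed _ (image-directed dir) λ i → pres-Con* gens (G∈ i))

    pres-Tot* : (∀ a b → tot₁ a b → tot (h₊ ⟦ a ⟧₊) (h₋ ⟦ b ⟧₋)) → ∀ {x y} → Tot* x y → tot (h₊ x) (h₋ y)
    pres-Tot* gens (gen a b ab) = gens a b ab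
    pres-Tot* gens (up α β α⊑β α∈) = tot-up (image α) (image β) (image-⊑ α⊑β) (pres-Tot* gens α∈)
    pres-Tot* gens tt* = tot-up _ _ (≈ₗ⇒⊒ image-tt) tot-tt
    pres-Tot* gens ff* = tot-up _ _ (≈ₗ⇒⊒ image-ff) tot-ff
    pres-Tot* gens (∧* α β α∈ β∈) =
      tot-up _ _ (≈ₗ⇒⊒ (image-∧ₗ α β)) (tot-∧ (image α) (image β) (pres-Tot* gens α∈) (pres-Tot* gens β∈))
    pres-Tot* gens (∨* α β α∈ β∈) =
      tot-up _ _ (≈ₗ⇒⊒ (image-∨ₗ α β)) (tot-∨ (image α) (image β) (pres-Tot* gens α∈) (pres-Tot* gens β∈))

  ⟦⟧-isPresentationPreserving : IsPresentationPreserving P 𝒢 ⟦_⟧₊ ⟦_⟧₋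
  ⟦⟧-isPresentationPreserving = record
    { cov₊     = CoverIdeals.⟦⟧-isCoverPreserving B₊ 𝒞₊
    ; cov₋     = CoverIdeals.⟦⟧-isCoverPreserving B₋ 𝒞₋
    ; pres-con = gen
    ; pres-tot = gen
    }

  module _ {c ℓ r : Level} (M : PreDFrame c ℓ r) {f₊ f₋}
           (pp : IsPresentationPreserving P (PreDFrame.ops M) f₊ f₋) where
    open PreDFrame M
    open IsPreDFrame isPreDFrame
    open IsPresentationPreserving pp
    private
      module E₊ = Extension B₊ 𝒞₊ frame₊ cov₊
      module E₋ = Extension B₋ 𝒞₋ frame₋ cov₋
      module F₊ = FrameProperties frame₊
      module F₋ = FrameProperties frame₋

    extend-isDFrameHom : IsDFrameHom 𝒢 ops E₊.extend E₋.extend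
    extend-isDFrameHom = record
      { hom₊     = E₊.extend-isFrameHom
      ; hom₋     = E₋.extend-isFrameHom
      ; pres-con = λ _ _ → pres-Con* M E₊.extend-isFrameHom E₋.extend-isFrameHom λ a b ab →
          con-down _ _ (F₊.reflexive (E₊.extend-⟦⟧ a) , F₋.reflexive (E₋.extend-⟦⟧ b)) (pres-con a b ab)
      ; pres-tot = λ _ _ → pres-Tot* M E₊.extend-isFrameHom E₋.extend-isFrameHom λ a b ab →
          tot-up _ _ (F₊.reflexive (F₊.≈.sym (E₊.extend-⟦⟧ a)) , F₋.reflexive (F₋.≈.sym (E₋.extend-⟦⟧ b)))
                 (pres-tot a b ab)
      }

lemma4 : ∀ {c ℓ r : Level} (P : Presentation) →
  let open Presentation P
      open Generated P
  in IsPresentationPreserving P 𝒢 ⟦_⟧₊ ⟦_⟧₋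
     × ((M : PreDFrame c ℓ r) →
        let module M₊ = FrameOps (PreDFrame.M₊ M)
            module M₋ = FrameOps (PreDFrame.M₋ M)
        in (f₊ : MeetSL.Carrier B₊ → M₊.Carrier) (f₋ : MeetSL.Carrier B₋ → M₋.Carrier) →
           IsPresentationPreserving P (PreDFrame.ops M) f₊ f₋ →
           Σ (FrameOps.Carrier L₊ → M₊.Carrier) λ h₊ →
           Σ (FrameOps.Carrier L₋ → M₋.Carrier) λ h₋ →
             IsDFrameHom 𝒢 (PreDFrame.ops M) h₊ h₋
             × (∀ a → h₊ ⟦ a ⟧₊ M₊.≈ f₊ a)
             × (∀ b → h₋ ⟦ b ⟧₋ M₋.≈ f₋ b)
             × (∀ (g₊ : FrameOps.Carrier L₊ → M₊.Carrier) (g₋ : FrameOps.Carrier L₋ → M₋.Carrier) →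
                  IsDFrameHom 𝒢 (PreDFrame.ops M) g₊ g₋ →
                  (∀ a → g₊ ⟦ a ⟧₊ M₊.≈ f₊ a) → (∀ b → g₋ ⟦ b ⟧₋ M₋.≈ f₋ b) →
                  (∀ x → g₊ x M₊.≈ h₊ x) × (∀ y → g₋ y M₋.≈ h₋ y))
             × (∀ (g₊ : FrameOps.Carrier L₊ → M₊.Carrier) → IsFrameHom L₊ (PreDFrame.M₊ M) g₊ →
                  (∀ a → g₊ ⟦ a ⟧₊ M₊.≈ f₊ a) → ∀ x → g₊ x M₊.≈ h₊ x)
             × (∀ (g₋ : FrameOps.Carrier L₋ → M₋.Carrier) → IsFrameHom L₋ (PreDFrame.M₋ M) g₋ →
                  (∀ b → g₋ ⟦ b ⟧₋ M₋.≈ f₋ b) → ∀ y → g₋ y M₋.≈ h₋ y))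
lemma4 P = ⟦⟧-isPresentationPreserving , λ M f₊ f₋ pp →
  let open IsPreDFrame (PreDFrame.isPreDFrame M)
      open IsPresentationPreserving pp
      module E₊ = Extension B₊ 𝒞₊ frame₊ cov₊
      module E₋ = Extension B₋ 𝒞₋ frame₋ cov₋
  in  E₊.extend , E₋.extend , extend-isDFrameHom M pp , E₊.extend-⟦⟧ , E₋.extend-⟦⟧
    , (λ g₊ g₋ g g₊⟦⟧≈f₊ g₋⟦⟧≈f₋ → E₊.extend-unique g₊ (IsDFrameHom.hom₊ g) g₊⟦⟧≈f₊
                                  , E₋.extend-unique g₋ (IsDFrameHom.hom₋ g) g₋⟦⟧≈f₋)
    , E₊.extend-unique , E₋.extend-unique
  where
  open Presentation P
  open GeneratedPreDFrame P
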